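{- Let $r\ge 0$ be an integer, $R=2^r$, $W=\sqrt{R^2+2R}$, $\lambda=\frac{R+W}{2}$, $\mu=\frac{R-W}{2}$, and for every integer $n$ let $P_R(n)=\frac{2}{RW}(\lambda^n-\mu^n)$. For an integer $m\ge1$ let $F_m(z)=\sum_{n\ge0}P_R(mn)z^n$. Then \[ F_m(z)=\frac{2^mzP_R(m)}{2^m-z\bigl(R(R+1)2^{m-1}P_R(m)-R^22^{m-2}P_R(m-2)\bigr)+(-1)^mz^2R^m}. \]
   Context: $P_R(n)$ are the (shifted) generalized $r$-Pell numbers, with $P_R(0)=0$, $P_R(1)=2/R$, $P_R(2)=2$ and $2P_R(n+2)=2RP_R(n+1)+RP_R(n)$. The Binet formula defines $P_R(n)$ also for negative $n$ (e.g. $P_R(-1)=4/R^2$, used when $m=1$). The identity is one of formal power series (equivalently, of analytic functions near $z=0$). -}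

module Defs where

open import Data.Nat as ℕ using (ℕ; zero; suc; _∸_)
open import Data.Nat.Properties using (m^n≢0)
open import Data.Integer as ℤ using (ℤ; +_; -[1+_])
open import Data.Rational using (ℚ; _+_; _*_; _-_; -_; _/_; ½; 0ℚ; 1ℚ)
open import Data.List using (List; map; foldr; upTo)

pow : ℚ → ℕ → ℚ
pow x zero    = 1ℚ
pow x (suc n) = x * pow x n

pow2ℤ : ℤ → ℚ
pow2ℤ (+ n)    = pow (+ 2 / 1) n
pow2ℤ -[1+ k ] = pow ½ (suc k)

Rq : ℕ → ℚ
Rq r = + (2 ℕ.^ r) / 1

invR : ℕ → ℚ
invR r = _/_ (+ 1) (2 ℕ.^ r) {{m^n≢0 2 r}}

Pℕ : ℕ → ℕ → ℚ
Pℕ r zero          = 0ℚ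
Pℕ r (suc zero)    = _/_ (+ 2) (2 ℕ.^ r) {{m^n≢0 2 r}}
Pℕ r (suc (suc n)) = Rq r * Pℕ r (suc n) + ½ * Rq r * Pℕ r n

-- Pneg r k = P_R(-k), extending the recurrence backwards:
-- P(n) = (2/R) P(n+2) - 2 P(n+1)   (agrees with the Binet formula)
Pneg : ℕ → ℕ → ℚ
Pneg r zero          = Pℕ r 0
Pneg r (suc zero)    = (+ 2 / 1) * invR r * Pℕ r 1 - (+ 2 / 1) * Pℕ r 0
Pneg r (suc (suc k)) = (+ 2 / 1) * invR r * Pneg r k - (+ 2 / 1) * Pneg r (suc k)

P : ℕ → ℤ → ℚ
P r (+ n)    = Pℕ r n
P r -[1+ k ] = Pneg r (suc k)

PowerSeries : Set
PowerSeries = ℕ → ℚ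

sumℚ : List ℚ → ℚ
sumℚ = foldr _+_ 0ℚ

_⊛_ : PowerSeries → PowerSeries → PowerSeries
(f ⊛ g) n = sumℚ (map (λ i → f i * g (n ∸ i)) (upTo (suc n)))

F : ℕ → ℕ → PowerSeries
F r m n = P r (+ (m ℕ.* n))

-- coefficient of z in the denominator (without the sign):
-- R(R+1) 2^{m-1} P_R(m) - R^2 2^{m-2} P_R(m-2)
middleCoeff : ℕ → ℕ → ℚ
middleCoeff r m =
  Rq r * (Rq r + 1ℚ) * pow2ℤ (+ m ℤ.- + 1) * P r (+ m)
  - pow (Rq r) 2 * pow2ℤ (+ m ℤ.- + 2) * P r (+ m ℤ.- + 2)

Denom : ℕ → ℕ → PowerSeries
Denom r m zero                = pow2ℤ (+ m)
Denom r m (suc zero)          = - middleCoeff r m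
Denom r m (suc (suc zero))    = pow (- 1ℚ) m * pow (Rq r) m
Denom r m (suc (suc (suc _))) = 0ℚ

Numer : ℕ → ℕ → PowerSeries
Numer r m zero          = 0ℚ
Numer r m (suc zero)    = pow2ℤ (+ m) * P r (+ m)
Numer r m (suc (suc _)) = 0ℚ

{-# OPTIONS --safe #-}
-- With λ, μ the roots of z² = R z + R/2, every stride-m subsequence of a solution of the
-- recurrence satisfies x(k + 2m) = (λ^m + μ^m) x(k + m) − (λμ)^m x(k). Both coefficients are
-- rational: writing x(m + k) = U_m x(k + 1) + V_m x(k), they are the trace U_(m+1) + V_m and the
-- determinant U_(m+1) V_m − V_(m+1) U_m = (−R/2)^m of a power of the companion matrix.
-- Multiplied by 2^m, 1 − (λ^m + μ^m) z + (λμ)^m z² is the denominator, so F_m times the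
-- denominator has no coefficient beyond z, and its coefficients at 1 and z are 0 and 2^m P_R(m).
module Submission where

open import Defs
open import Data.Nat as ℕ using (ℕ; _≥_; zero; suc; _∸_)
open import Data.Nat.Properties as ℕ using (+-suc; +-identityʳ; *-suc; *-zeroʳ; *-identityʳ)
open import Data.Integer as ℤ using (+_)
import Data.Integer.Properties as ℤ
open import Data.Rational using (ℚ; _+_; _*_; _-_; -_; _/_; ½; 0ℚ; 1ℚ; toℚᵘ)
open import Data.Rational.Properties using (toℚᵘ-injective; toℚᵘ-fromℚᵘ; toℚᵘ-homo-*)
open import Data.Rational.Solver using (module +-*-Solver)
import Data.Rational.Unnormalised as ℚᵘ
import Data.Rational.Unnormalised.Properties as ℚᵘ
open import Data.List using (map)
open import Data.List.Properties using (map-applyUpTo; map-upTo)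
open import Function using (_∘_)
open import Relation.Binary.PropositionalEquality using (_≡_; refl; sym; trans; cong; cong₂; module ≡-Reasoning)

open +-*-Solver

two : ℚ
two = + 2 / 1

n*[i/n]≡i : ∀ i n .{{_ : ℕ.NonZero n}} → (+ n / 1) * (i / n) ≡ i / 1
-- i / suc k is definitionally fromℚᵘ (mkℚᵘ i k), so toℚᵘ-fromℚᵘ moves the product to ℚᵘ.
n*[i/n]≡i i n@(suc _) = toℚᵘ-injective (begin
  toℚᵘ ((+ n / 1) * (i / n))            ≈⟨ toℚᵘ-homo-* (+ n / 1) (i / n) ⟩
  toℚᵘ (+ n / 1) ℚᵘ.* toℚᵘ (i / n)      ≈⟨ ℚᵘ.*-cong (toℚᵘ-fromℚᵘ (+ n ℚᵘ./ 1)) (toℚᵘ-fromℚᵘ (i ℚᵘ./ n)) ⟩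
  (+ n ℚᵘ./ 1) ℚᵘ.* (i ℚᵘ./ n)          ≈⟨ ℚᵘ.*≡* n*i*1≡i*[1*n] ⟩
  i ℚᵘ./ 1                              ≈⟨ ℚᵘ.≃-sym (toℚᵘ-fromℚᵘ (i ℚᵘ./ 1)) ⟩
  toℚᵘ (i / 1)                          ∎)
  where
  open ℚᵘ.≃-Reasoning
  n*i*1≡i*[1*n] : (+ n ℤ.* i) ℤ.* + 1 ≡ i ℤ.* (+ 1 ℤ.* + n)
  n*i*1≡i*[1*n] = trans (ℤ.*-identityʳ _) (trans (ℤ.*-comm (+ n) i) (cong (i ℤ.*_) (sym (ℤ.*-identityˡ (+ n)))))

pow-distrib-* : ∀ x y n → pow (x * y) n ≡ pow x n * pow y n
pow-distrib-* x y zero    = refl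
pow-distrib-* x y (suc n) = begin
  (x * y) * pow (x * y) n          ≡⟨ cong ((x * y) *_) (pow-distrib-* x y n) ⟩
  (x * y) * (pow x n * pow y n)    ≡⟨ solve 4 (λ x y u v → (x :* y) :* (u :* v) := (x :* u) :* (y :* v)) refl x y (pow x n) (pow y n) ⟩
  (x * pow x n) * (y * pow y n)    ∎
  where open ≡-Reasoning

⊛-suc : ∀ (f g : PowerSeries) n → (f ⊛ g) (suc n) ≡ f 0 * g (suc n) + ((f ∘ suc) ⊛ g) n
⊛-suc f g n = cong (λ xs → f 0 * g (suc n) + sumℚ xs)
  (trans (map-applyUpTo suc term (suc n)) (sym (map-upTo (term ∘ suc) (suc n))))
  where
  term : ℕ → ℚ
  term i = f i * g (suc n ∸ i)

⊛-degree≤2 : ∀ {g : PowerSeries} → (∀ k → g (suc (suc (suc k))) ≡ 0ℚ) →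
             ∀ f n → (f ⊛ g) (suc (suc n)) ≡ f n * g 2 + f (suc n) * g 1 + f (suc (suc n)) * g 0
⊛-degree≤2 {g} _       f zero    =
  solve 6 (λ f₀ f₁ f₂ g₀ g₁ g₂ → f₀ :* g₂ :+ (f₁ :* g₁ :+ (f₂ :* g₀ :+ con 0ℚ)) := f₀ :* g₂ :+ f₁ :* g₁ :+ f₂ :* g₀)
    refl (f 0) (f 1) (f 2) (g 0) (g 1) (g 2)
⊛-degree≤2 {g} g₃₊≡0 f (suc n) = begin
  (f ⊛ g) (suc (suc (suc n)))
    ≡⟨ ⊛-suc f g (suc (suc n)) ⟩
  f 0 * g (suc (suc (suc n))) + ((f ∘ suc) ⊛ g) (suc (suc n))
    ≡⟨ cong₂ (λ u v → f 0 * u + v) (g₃₊≡0 n) (⊛-degree≤2 {g} g₃₊≡0 (f ∘ suc) n) ⟩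
  f 0 * 0ℚ + S
    ≡⟨ solve 2 (λ x s → x :* con 0ℚ :+ s := s) refl (f 0) S ⟩
  S ∎
  where
  open ≡-Reasoning
  S = f (suc n) * g 2 + f (suc (suc n)) * g 1 + f (suc (suc (suc n))) * g 0

⊛-denominator-vanishes : ∀ {f g : PowerSeries} {t d : ℚ} →
  (∀ n → f (suc (suc n)) ≡ t * f (suc n) - d * f n) →
  (∀ k → g (suc (suc (suc k))) ≡ 0ℚ) → g 1 ≡ - (g 0 * t) → g 2 ≡ g 0 * d →
  ∀ n → (f ⊛ g) (suc (suc n)) ≡ 0ℚ
⊛-denominator-vanishes {f} {g} {t} {d} rec g₃₊≡0 g₁≡ g₂≡ n = begin
  (f ⊛ g) (suc (suc n))
    ≡⟨ ⊛-degree≤2 {g} g₃₊≡0 f n ⟩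
  f₀ * g 2 + f₁ * g 1 + f (suc (suc n)) * g 0
    ≡⟨ cong₂ (λ u v → f₀ * u + f₁ * v + f (suc (suc n)) * g 0) g₂≡ g₁≡ ⟩
  f₀ * (g 0 * d) + f₁ * - (g 0 * t) + f (suc (suc n)) * g 0
    ≡⟨ cong (λ u → f₀ * (g 0 * d) + f₁ * - (g 0 * t) + u * g 0) (rec n) ⟩
  f₀ * (g 0 * d) + f₁ * - (g 0 * t) + (t * f₁ - d * f₀) * g 0
    ≡⟨ solve 5 (λ f₀ f₁ c t d → f₀ :* (c :* d) :+ f₁ :* (:- (c :* t)) :+ (t :* f₁ :- d :* f₀) :* c := con 0ℚ)
         refl f₀ f₁ (g 0) t d ⟩
  0ℚ ∎
  where
  open ≡-Reasoning
  f₀ = f n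
  f₁ = f (suc n)

module SecondOrderRecurrence (a b : ℚ) where

  -- U is the Lucas sequence U_m(a, −b), and V m = b U_(m−1).
  mutual
    U : ℕ → ℚ
    U zero    = 0ℚ
    U (suc m) = a * U m + V m

    V : ℕ → ℚ
    V zero    = 1ℚ
    V (suc m) = b * U m

  trace : ℕ → ℚ
  trace m = U (suc m) + V m

  det : ℕ → ℚ
  det m = U (suc m) * V m - V (suc m) * U m

  det≡[-b]^m : ∀ m → det m ≡ pow (- b) m
  det≡[-b]^m zero    = solve 2 (λ a b → (a :* con 0ℚ :+ con 1ℚ) :* con 1ℚ :- (b :* con 0ℚ) :* con 0ℚ := con 1ℚ) refl a b
  det≡[-b]^m (suc m) = begin
    det (suc m)  ≡⟨ solve 4 (λ a b u v → (a :* (a :* u :+ v) :+ b :* u) :* (b :* u) :- (b :* (a :* u :+ v)) :* (a :* u :+ v)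
                                       := (:- b) :* ((a :* u :+ v) :* v :- (b :* u) :* u)) refl a b (U m) (V m) ⟩
    - b * det m  ≡⟨ cong (- b *_) (det≡[-b]^m m) ⟩
    pow (- b) (suc m) ∎
    where open ≡-Reasoning

  module _ (x : ℕ → ℚ) (rec : ∀ n → x (suc (suc n)) ≡ a * x (suc n) + b * x n) where

    x-expansion : ∀ m k → x (m ℕ.+ k) ≡ U m * x (suc k) + V m * x k
    x-expansion zero    k = solve 2 (λ y z → z := con 0ℚ :* y :+ con 1ℚ :* z) refl (x (suc k)) (x k)
    x-expansion (suc m) k = begin
      x (suc m ℕ.+ k)                                      ≡⟨ cong x (sym (+-suc m k)) ⟩
      x (m ℕ.+ suc k)                                      ≡⟨ x-expansion m (suc k) ⟩
      U m * x (suc (suc k)) + V m * x (suc k)              ≡⟨ cong (λ y → U m * y + V m * x (suc k)) (rec k) ⟩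
      U m * (a * x (suc k) + b * x k) + V m * x (suc k)    ≡⟨ solve 6 (λ a b u v y z → u :* (a :* y :+ b :* z) :+ v :* y
                                                                  := (a :* u :+ v) :* y :+ (b :* u) :* z) refl a b (U m) (V m) (x (suc k)) (x k) ⟩
      U (suc m) * x (suc k) + V (suc m) * x k              ∎
      where open ≡-Reasoning

    -- Eliminating x (k + 1) between the expansions of x (m + k), x (m + 1 + k) and x (m + (m + k)).
    x-stride : ∀ m k → x (m ℕ.+ (m ℕ.+ k)) ≡ trace m * x (m ℕ.+ k) - det m * x k
    x-stride m k = begin
      x (m ℕ.+ (m ℕ.+ k))                                  ≡⟨ x-expansion m (m ℕ.+ k) ⟩
      U m * x (suc m ℕ.+ k) + V m * x (m ℕ.+ k)            ≡⟨ cong₂ (λ y z → U m * y + V m * z) (x-expansion (suc m) k) (x-expansion m k) ⟩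
      U m * (U (suc m) * y₁ + V (suc m) * y₀) + V m * (U m * y₁ + V m * y₀)
        ≡⟨ solve 6 (λ u v u′ v′ y₁ y₀ → u :* (u′ :* y₁ :+ v′ :* y₀) :+ v :* (u :* y₁ :+ v :* y₀)
                                       := (u′ :+ v) :* (u :* y₁ :+ v :* y₀) :- (u′ :* v :- v′ :* u) :* y₀)
             refl (U m) (V m) (U (suc m)) (V (suc m)) y₁ y₀ ⟩
      trace m * (U m * y₁ + V m * y₀) - det m * y₀         ≡⟨ cong (λ z → trace m * z - det m * y₀) (sym (x-expansion m k)) ⟩
      trace m * x (m ℕ.+ k) - det m * x k                  ∎
      where
      open ≡-Reasoning
      y₁ = x (suc k)
      y₀ = x k

module RPell (r : ℕ) where

  R : ℚ
  R = Rq r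

  open SecondOrderRecurrence R (½ * R) public

  P-stride : ∀ m k → Pℕ r (m ℕ.+ (m ℕ.+ k)) ≡ trace m * Pℕ r (m ℕ.+ k) - det m * Pℕ r k
  P-stride = x-stride (Pℕ r) (λ _ → refl)

  R*P₁≡2 : R * Pℕ r 1 ≡ two
  R*P₁≡2 = n*[i/n]≡i (+ 2) (2 ℕ.^ r) {{ℕ.m^n≢0 2 r}}

  R*R⁻¹≡1 : R * invR r ≡ 1ℚ
  R*R⁻¹≡1 = n*[i/n]≡i (+ 1) (2 ℕ.^ r) {{ℕ.m^n≢0 2 r}}

  R*P≡2*U : ∀ m → R * Pℕ r m ≡ two * U m
  R*P≡2*U m = begin
    R * Pℕ r m                              ≡⟨ cong ((R *_) ∘ Pℕ r) (sym (+-identityʳ m)) ⟩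
    R * Pℕ r (m ℕ.+ 0)                      ≡⟨ cong (R *_) (x-expansion (Pℕ r) (λ _ → refl) m 0) ⟩
    R * (U m * Pℕ r 1 + V m * 0ℚ)           ≡⟨ solve 4 (λ ρ u v p → ρ :* (u :* p :+ v :* con 0ℚ) := (ρ :* p) :* u) refl R (U m) (V m) (Pℕ r 1) ⟩
    (R * Pℕ r 1) * U m                      ≡⟨ cong (_* U m) R*P₁≡2 ⟩
    two * U m                               ∎
    where open ≡-Reasoning

  2^m*det≡[-1]^m*R^m : ∀ m → pow2ℤ (+ m) * det m ≡ pow (- 1ℚ) m * pow R m
  2^m*det≡[-1]^m*R^m m = begin
    pow two m * det m             ≡⟨ cong (pow two m *_) (det≡[-b]^m m) ⟩
    pow two m * pow (- (½ * R)) m ≡⟨ sym (pow-distrib-* two (- (½ * R)) m) ⟩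
    pow (two * - (½ * R)) m       ≡⟨ cong (λ y → pow y m) (solve 1 (λ ρ → con two :* (:- (con ½ :* ρ)) := con (- 1ℚ) :* ρ) refl R) ⟩
    pow (- 1ℚ * R) m              ≡⟨ pow-distrib-* (- 1ℚ) R m ⟩
    pow (- 1ℚ) m * pow R m        ∎
    where open ≡-Reasoning

  middleCoeff≡2^m*trace : ∀ m → middleCoeff r (suc m) ≡ pow2ℤ (+ suc m) * trace (suc m)
  -- Here 2^(m−2) = ½ and P_R(m − 2) = P_R(−1) = (2/R) P_R(1), which is where R⁻¹ enters.
  middleCoeff≡2^m*trace zero = begin
    R * (R + 1ℚ) * 1ℚ * P₁ - R * (R * 1ℚ) * (½ * 1ℚ) * (two * invR r * P₁ - two * 0ℚ)
      ≡⟨ solve 3 (λ ρ p ι → ρ :* (ρ :+ con 1ℚ) :* con 1ℚ :* p :- ρ :* (ρ :* con 1ℚ) :* (con ½ :* con 1ℚ) :* (con two :* ι :* p :- con two :* con 0ℚ)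
                          := (ρ :+ con 1ℚ) :* (ρ :* p) :- (ρ :* ι) :* (ρ :* p)) refl R P₁ (invR r) ⟩
    (R + 1ℚ) * (R * P₁) - (R * invR r) * (R * P₁)
      ≡⟨ cong₂ (λ y z → (R + 1ℚ) * y - z * y) R*P₁≡2 R*R⁻¹≡1 ⟩
    (R + 1ℚ) * two - 1ℚ * two
      ≡⟨ solve 1 (λ ρ → (ρ :+ con 1ℚ) :* con two :- con 1ℚ :* con two
                     := (con two :* con 1ℚ) :* ((ρ :* (ρ :* con 0ℚ :+ con 1ℚ) :+ con ½ :* ρ :* con 0ℚ) :+ con ½ :* ρ :* con 0ℚ)) refl R ⟩
    pow2ℤ (+ 1) * trace 1
      ∎
    where
    open ≡-Reasoning
    P₁ = Pℕ r 1
  -- R P_R(m) = 2 U_m turns both sides into expressions in U, which agree because b = R/2.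
  middleCoeff≡2^m*trace (suc j) = begin
    R * (R + 1ℚ) * (two * p) * Pℕ r (suc (suc j)) - R * (R * 1ℚ) * p * Pℕ r j
      ≡⟨ solve 4 (λ ρ p x y → ρ :* (ρ :+ con 1ℚ) :* (con two :* p) :* x :- ρ :* (ρ :* con 1ℚ) :* p :* y
                            := (ρ :+ con 1ℚ) :* (con two :* p) :* (ρ :* x) :- ρ :* p :* (ρ :* y)) refl R p (Pℕ r (suc (suc j))) (Pℕ r j) ⟩
    (R + 1ℚ) * (two * p) * (R * Pℕ r (suc (suc j))) - R * p * (R * Pℕ r j)
      ≡⟨ cong₂ (λ y z → (R + 1ℚ) * (two * p) * y - R * p * z) (R*P≡2*U (suc (suc j))) (R*P≡2*U j) ⟩
    (R + 1ℚ) * (two * p) * (two * U (suc (suc j))) - R * p * (two * U j)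
      ≡⟨ solve 4 (λ ρ p u₁ u₀ →
           (ρ :+ con 1ℚ) :* (con two :* p) :* (con two :* (ρ :* u₁ :+ con ½ :* ρ :* u₀)) :- ρ :* p :* (con two :* u₀)
           := (con two :* (con two :* p)) :* ((ρ :* (ρ :* u₁ :+ con ½ :* ρ :* u₀) :+ con ½ :* ρ :* u₁) :+ con ½ :* ρ :* u₁))
           refl R p (U (suc j)) (U j) ⟩
    pow2ℤ (+ suc (suc j)) * trace (suc (suc j))
      ∎
    where
    open ≡-Reasoning
    p = pow two j

  F-recurrence : ∀ m n → F r m (suc (suc n)) ≡ trace m * F r m (suc n) - det m * F r m n
  F-recurrence m n = begin
    Pℕ r (m ℕ.* suc (suc n))                            ≡⟨ cong (Pℕ r) (trans (*-suc m (suc n)) (cong (m ℕ.+_) (*-suc m n))) ⟩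
    Pℕ r (m ℕ.+ (m ℕ.+ m ℕ.* n))                        ≡⟨ P-stride m (m ℕ.* n) ⟩
    trace m * Pℕ r (m ℕ.+ m ℕ.* n) - det m * F r m n    ≡⟨ cong (λ k → trace m * Pℕ r k - det m * F r m n) (sym (*-suc m n)) ⟩
    trace m * F r m (suc n) - det m * F r m n           ∎
    where open ≡-Reasoning

mainTheorem2 : (r m : ℕ) → m ≥ 1 → (n : ℕ) → (F r m ⊛ Denom r m) n ≡ Numer r m n
mainTheorem2 r m _ zero rewrite *-zeroʳ m =
  solve 1 (λ c → con 0ℚ :* c :+ con 0ℚ := con 0ℚ) refl (pow2ℤ (+ m))
mainTheorem2 r m _ (suc zero) rewrite *-zeroʳ m | *-identityʳ m =
  solve 3 (λ c₀ c₁ p → con 0ℚ :* c₁ :+ (p :* c₀ :+ con 0ℚ) := c₀ :* p) refl (pow2ℤ (+ m)) (Denom r m 1) (Pℕ r m)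
mainTheorem2 r (suc m) _ (suc (suc n)) =
  ⊛-denominator-vanishes {F r (suc m)} {Denom r (suc m)} (F-recurrence (suc m)) (λ _ → refl)
    (cong -_ (middleCoeff≡2^m*trace m)) (sym (2^m*det≡[-1]^m*R^m (suc m))) n
  where open RPell r
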